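{- The $B$-term $B^2=B\circ B$ (i.e. $B\,B\,B$) does not have the $\rho$-property: there are no two distinct positive integers $i\neq j$ such that $(B^2)_{(i)}$ and $(B^2)_{(j)}$ are $\beta\eta$-equivalent.
   Context: $B=\lambda f.\lambda g.\lambda x.\, f\,(g\,x)$ and $e_1\circ e_2$ denotes $B\,e_1\,e_2$. For a term $X$ and $k\ge1$, $X_{(k)}$ denotes $X\,X\cdots X$ ($k$ copies, application associated to the left). A term $X$ has the $\rho$-property if there are distinct positive integers $i,j$ with $X_{(i)}=X_{(j)}$ up to $\beta\eta$-equivalence. -}

module Defs where

open import Data.Nat using (ℕ; zero; suc; _≤_)
open import Data.Product using (Σ; _×_; ∃-syntax)
open import Relation.Binary.PropositionalEquality using (_≢_)

data Term : Set where
  var : ℕ → Term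
  app : Term → Term → Term
  lam : Term → Term

ext : (ℕ → ℕ) → ℕ → ℕ
ext ρ zero    = zero
ext ρ (suc n) = suc (ρ n)

rename : (ℕ → ℕ) → Term → Term
rename ρ (var x)   = var (ρ x)
rename ρ (app a b) = app (rename ρ a) (rename ρ b)
rename ρ (lam t)   = lam (rename (ext ρ) t)

exts : (ℕ → Term) → ℕ → Term
exts σ zero    = var zero
exts σ (suc n) = rename suc (σ n)

subst : (ℕ → Term) → Term → Term
subst σ (var x)   = σ x
subst σ (app a b) = app (subst σ a) (subst σ b)
subst σ (lam t)   = lam (subst (exts σ) t)

single : Term → ℕ → Term
single s zero    = s
single s (suc n) = var n

_[_] : Term → Term → Term
t [ s ] = subst (single s) t

infix 4 _≡βη_
data _≡βη_ : Term → Term → Set where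
  βη-refl  : ∀ {t} → t ≡βη t
  βη-sym   : ∀ {s t} → s ≡βη t → t ≡βη s
  βη-trans : ∀ {s t u} → s ≡βη t → t ≡βη u → s ≡βη u
  βη-app   : ∀ {a a′ b b′} → a ≡βη a′ → b ≡βη b′ → app a b ≡βη app a′ b′
  βη-lam   : ∀ {t t′} → t ≡βη t′ → lam t ≡βη lam t′
  β        : ∀ {t s} → app (lam t) s ≡βη t [ s ]
  η        : ∀ {t} → lam (app (rename suc t) (var zero)) ≡βη t

-- B = λf.λg.λx. f (g x)
B : Term
B = lam (lam (lam (app (var 2) (app (var 1) (var 0)))))

_∘B_ : Term → Term → Term
e₁ ∘B e₂ = app (app B e₁) e₂

B² : Term
B² = B ∘B B

-- X₍ₖ₎ = X X ⋯ X (k copies, left-associated), for k ≥ 1.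
-- (The value at k = 0 is a junk value and is never used.)
copies : Term → ℕ → Term
copies X zero          = X
copies X (suc zero)    = X
copies X (suc (suc k)) = app (copies X (suc k)) X

HasRho : Term → Set
HasRho X = ∃[ i ] ∃[ j ] (1 ≤ i × 1 ≤ j × i ≢ j × copies X i ≡βη copies X j)

-- βη-reduction is confluent (β and η are each confluent and commute, so Hindley–Rosen applies),
-- hence βη-equal normal forms coincide. Each (B²)₍ₖ₎ β-reduces to a normal form λ…λ. Q Q′ or
-- λ…λ. x Q, where Q, Q′ are nested neutral terms (nest) whose depths record a pair (a , b) or a
-- number c. Applying B² substitutes it for the head variable, which carries three arguments in the
-- first case and one in the second, and yields the next normal form of this kind:
-- (a + 1 , b) ↦ (a , b + 1), (0 , b) ↦ b + 1 and c ↦ (c , 0). This walk never revisits a shape, so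
-- distinct iterates have distinct normal forms.
module Submission where

open import Defs
open import Level using (Level)
open import Relation.Nullary using (¬_)
open import Data.Nat using (ℕ; zero; suc; _+_; _<_; s≤s)
open import Data.Nat.Properties using (+-suc; +-identityʳ; +-comm; n<1+n; m≤n+m; suc-injective; <⇒≤; <-trans; ≤-<-trans)
open import Data.Product using (∃; -,_; _×_; _,_; proj₁; proj₂; map; map₁; map₂; swap)
open import Data.Sum as Sum using (inj₁; inj₂)
open import Data.Empty using (⊥; ⊥-elim)
open import Data.Unit using (⊤)
open import Function using (_∘_)
open import Relation.Binary.Core using (Rel; _⇒_)
open import Relation.Binary.PropositionalEquality as ≡
  using (_≡_; _≢_; refl; sym; trans; cong; cong₂; _≗_; module ≡-Reasoning)
open import Relation.Binary.Construct.Union using (_∪_)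
open import Relation.Binary.Construct.Closure.Reflexive as Refl using (ReflClosure)
open import Relation.Binary.Construct.Closure.ReflexiveTransitive as Star
  using (Star; ε; _◅_; _◅◅_; return; _⋆)
open import Relation.Binary.Construct.Closure.ReflexiveTransitive.Properties
  using (module StarReasoning) renaming (reflexive to ≡⇒star)
open import Relation.Binary.Construct.Closure.Symmetric using (fwd)
open import Relation.Binary.Construct.Closure.Equivalence as EqClosure using (EqClosure)
open import Relation.Binary.Rewriting using (Confluent; IsNormalForm; conf⇒unf)

private
  variable
    a ℓ ℓ₁ ℓ₂ : Level
    A : Set a

-- Abstract rewriting

Diamond : Rel A ℓ → Set _
Diamond R = ∀ {x y z} → R x y → R x z → ∃ λ w → R y w × R z w

reflClosure⇒star : {R : Rel A ℓ} → ReflClosure R ⇒ Star R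
reflClosure⇒star Refl.refl    = ε
reflClosure⇒star Refl.[ r ] = return r

module _ {R : Rel A ℓ} (◇ : Diamond R) where

  diamond-strip : ∀ {x y z} → R x y → Star R x z → ∃ λ w → Star R y w × R z w
  diamond-strip r ε = -, ε , r
  diamond-strip r (s ◅ ss) with ◇ r s
  ... | _ , r′ , s′ = map₂ (map₁ (r′ ◅_)) (diamond-strip s′ ss)

  diamond⇒confluent : Confluent R
  diamond⇒confluent ε ss = -, ss , ε
  diamond⇒confluent (r ◅ rs) ss with diamond-strip r ss
  ... | _ , ss′ , r′ = map₂ (map₂ (r′ ◅_)) (diamond⇒confluent rs ss′)

diamond-between⇒confluent : {R : Rel A ℓ₁} {S : Rel A ℓ₂} →
  R ⇒ S → S ⇒ Star R → Diamond S → Confluent R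
diamond-between⇒confluent R⊆S S⊆R* ◇ rs rs′ =
  map₂ (map (S⊆R* ⋆) (S⊆R* ⋆)) (diamond⇒confluent ◇ (Star.map R⊆S rs) (Star.map R⊆S rs′))

Commute : Rel A ℓ₁ → Rel A ℓ₂ → Set _
Commute R S = ∀ {x y z} → Star R x y → Star S x z → ∃ λ w → Star S y w × Star R z w

module _ {R : Rel A ℓ₁} {S : Rel A ℓ₂}
         (local : ∀ {x y z} → R x y → S x z → ∃ λ w → Star S y w × ReflClosure R z w) where

  commute-strip : ∀ {x y z} → R x y → Star S x z → ∃ λ w → Star S y w × ReflClosure R z w
  commute-strip r ε = -, ε , Refl.[ r ]
  commute-strip r (s ◅ ss) with local r s
  ... | _ , ss₁ , Refl.refl = -, ss₁ ◅◅ ss , Refl.refl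
  ... | _ , ss₁ , Refl.[ r′ ] = map₂ (map₁ (ss₁ ◅◅_)) (commute-strip r′ ss)

  hindley : Commute R S
  hindley ε ss = -, ss , ε
  hindley (r ◅ rs) ss with commute-strip r ss
  ... | _ , ss′ , r′ = map₂ (map₂ (reflClosure⇒star r′ ◅◅_)) (hindley rs ss′)

hindley-rosen : {R : Rel A ℓ₁} {S : Rel A ℓ₂} →
  Confluent R → Confluent S → Commute R S → Confluent (R ∪ S)
hindley-rosen {R = R} {S} confR confS com =
  diamond-between⇒confluent (Sum.map return return)
    Sum.[ Star.map inj₁ , Star.map inj₂ ] ◇
  where
  ◇ : Diamond (Star R ∪ Star S)
  ◇ (inj₁ p) (inj₁ q) = map₂ (map inj₁ inj₁) (confR p q)
  ◇ (inj₂ p) (inj₂ q) = map₂ (map inj₂ inj₂) (confS p q)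
  ◇ (inj₁ p) (inj₂ q) = map₂ (map inj₂ inj₁) (com p q)
  ◇ (inj₂ p) (inj₁ q) = map₂ (swap ∘ map inj₂ inj₁) (com q p)

-- Renaming and substitution

private
  variable
    ρ ρ′ : ℕ → ℕ
    σ τ : ℕ → Term

ext-cong : ρ ≗ ρ′ → ext ρ ≗ ext ρ′
ext-cong e zero    = refl
ext-cong e (suc x) = cong suc (e x)

rename-cong : ρ ≗ ρ′ → rename ρ ≗ rename ρ′
rename-cong e (var x)   = cong var (e x)
rename-cong e (app s t) = cong₂ app (rename-cong e s) (rename-cong e t)
rename-cong e (lam t)   = cong lam (rename-cong (ext-cong e) t)

exts-cong : σ ≗ τ → exts σ ≗ exts τ
exts-cong e zero    = refl
exts-cong e (suc x) = cong (rename suc) (e x)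

subst-cong : σ ≗ τ → subst σ ≗ subst τ
subst-cong e (var x)   = e x
subst-cong e (app s t) = cong₂ app (subst-cong e s) (subst-cong e t)
subst-cong e (lam t)   = cong lam (subst-cong (exts-cong e) t)

rename-∘ : ∀ ρ ρ′ t → rename ρ (rename ρ′ t) ≡ rename (ρ ∘ ρ′) t
rename-∘ ρ ρ′ (var x)   = refl
rename-∘ ρ ρ′ (app s t) = cong₂ app (rename-∘ ρ ρ′ s) (rename-∘ ρ ρ′ t)
rename-∘ ρ ρ′ (lam t)   = cong lam (trans (rename-∘ (ext ρ) (ext ρ′) t)
  (rename-cong (λ { zero → refl ; (suc x) → refl }) t))

subst-rename : ∀ σ ρ t → subst σ (rename ρ t) ≡ subst (σ ∘ ρ) t
subst-rename σ ρ (var x)   = refl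
subst-rename σ ρ (app s t) = cong₂ app (subst-rename σ ρ s) (subst-rename σ ρ t)
subst-rename σ ρ (lam t)   = cong lam (trans (subst-rename (exts σ) (ext ρ) t)
  (subst-cong (λ { zero → refl ; (suc x) → refl }) t))

rename-subst : ∀ ρ σ t → rename ρ (subst σ t) ≡ subst (rename ρ ∘ σ) t
rename-subst ρ σ (var x)   = refl
rename-subst ρ σ (app s t) = cong₂ app (rename-subst ρ σ s) (rename-subst ρ σ t)
rename-subst ρ σ (lam t)   = cong lam (trans (rename-subst (ext ρ) (exts σ) t)
  (subst-cong (λ { zero → refl
                 ; (suc x) → trans (rename-∘ (ext ρ) suc (σ x)) (sym (rename-∘ suc ρ (σ x))) }) t))

subst-∘ : ∀ σ τ t → subst σ (subst τ t) ≡ subst (subst σ ∘ τ) t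
subst-∘ σ τ (var x)   = refl
subst-∘ σ τ (app s t) = cong₂ app (subst-∘ σ τ s) (subst-∘ σ τ t)
subst-∘ σ τ (lam t)   = cong lam (trans (subst-∘ (exts σ) (exts τ) t)
  (subst-cong (λ { zero → refl
                 ; (suc x) → trans (subst-rename (exts σ) suc (τ x)) (sym (rename-subst suc σ (τ x))) }) t))

subst-var : ∀ t → subst var t ≡ t
subst-var (var x)   = refl
subst-var (app s t) = cong₂ app (subst-var s) (subst-var t)
subst-var (lam t)   = cong lam (trans (subst-cong (λ { zero → refl ; (suc x) → refl }) t) (subst-var t))

shift-[] : ∀ t s → rename suc t [ s ] ≡ t
shift-[] t s = trans (subst-rename (single s) suc t) (subst-var t)

ext-shift-[var0] : ∀ t → rename (ext suc) t [ var zero ] ≡ t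
ext-shift-[var0] t = trans (subst-rename (single (var zero)) (ext suc) t)
  (trans (subst-cong (λ { zero → refl ; (suc x) → refl }) t) (subst-var t))

ext-shift : ∀ ρ t → rename (ext ρ) (rename suc t) ≡ rename suc (rename ρ t)
ext-shift ρ t = trans (rename-∘ (ext ρ) suc t) (sym (rename-∘ suc ρ t))

exts-shift : ∀ σ t → subst (exts σ) (rename suc t) ≡ rename suc (subst σ t)
exts-shift σ t = trans (subst-rename (exts σ) suc t) (sym (rename-subst suc σ t))

rename-[] : ∀ ρ t s → rename ρ (t [ s ]) ≡ rename (ext ρ) t [ rename ρ s ]
rename-[] ρ t s = trans (rename-subst ρ (single s) t)
  (trans (subst-cong (λ { zero → refl ; (suc x) → refl }) t)
         (sym (subst-rename (single (rename ρ s)) (ext ρ) t)))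

subst-[] : ∀ σ t s → subst σ (t [ s ]) ≡ subst (exts σ) t [ subst σ s ]
subst-[] σ t s = trans (subst-∘ σ (single s) t)
  (trans (subst-cong (λ { zero → refl
                        ; (suc x) → sym (shift-[] (σ x) (subst σ s)) }) t)
         (sym (subst-∘ (single (subst σ s)) (exts σ) t)))

shift-injective : ∀ {s t} → rename suc s ≡ rename suc t → s ≡ t
shift-injective {s} {t} e =
  trans (sym (shift-[] s (var zero))) (trans (cong (_[ var zero ]) e) (shift-[] t (var zero)))

var-injective : ∀ {x y} → var x ≡ var y → x ≡ y
var-injective refl = refl

app-injective : ∀ {s₁ s₂ t₁ t₂} → app s₁ s₂ ≡ app t₁ t₂ → s₁ ≡ t₁ × s₂ ≡ t₂
app-injective refl = refl , refl

lam-injective : ∀ {s t} → lam s ≡ lam t → s ≡ t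
lam-injective refl = refl

rename-pullback : ∀ {ρ ρ′ π π′} →
  (∀ x y → ρ x ≡ ρ′ y → ∃ λ z → x ≡ π z × y ≡ π′ z) →
  ∀ s t → rename ρ s ≡ rename ρ′ t → ∃ λ u → s ≡ rename π u × t ≡ rename π′ u
rename-pullback pb (var x) (var y) e with pb x y (var-injective e)
... | z , refl , refl = var z , refl , refl
rename-pullback pb (app s₁ s₂) (app t₁ t₂) e
  with rename-pullback pb s₁ t₁ (proj₁ (app-injective e))
     | rename-pullback pb s₂ t₂ (proj₂ (app-injective e))
... | u₁ , refl , refl | u₂ , refl , refl = app u₁ u₂ , refl , refl
rename-pullback {ρ} {ρ′} {π} {π′} pb (lam s) (lam t) e
  with rename-pullback {ext ρ} {ext ρ′} {ext π} {ext π′} pb′ s t (lam-injective e)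
  where
  pb′ : ∀ x y → ext ρ x ≡ ext ρ′ y → ∃ λ z → x ≡ ext π z × y ≡ ext π′ z
  pb′ zero    zero    _ = zero , refl , refl
  pb′ (suc x) (suc y) e with pb x y (suc-injective e)
  ... | z , refl , refl = suc z , refl , refl
... | u , refl , refl = lam u , refl , refl

-- Confluence of βη-reduction

infix 4 _→β_ _→η_ _⇛_ _→βη_

data _→β_ : Term → Term → Set where
  β-contract : ∀ {t s} → app (lam t) s →β t [ s ]
  β-appˡ     : ∀ {s s′ t} → s →β s′ → app s t →β app s′ t
  β-appʳ     : ∀ {s t t′} → t →β t′ → app s t →β app s t′
  β-lam      : ∀ {t t′} → t →β t′ → lam t →β lam t′

-- The η-redex is given by equations, so that matching on a step never has to unify with a `rename`.
data _→η_ : Term → Term → Set where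
  η-contract : ∀ {b s t} → b ≡ app s (var zero) → s ≡ rename suc t → lam b →η t
  η-appˡ     : ∀ {s s′ t} → s →η s′ → app s t →η app s′ t
  η-appʳ     : ∀ {s t t′} → t →η t′ → app s t →η app s t′
  η-lam      : ∀ {t t′} → t →η t′ → lam t →η lam t′

_→βη_ : Rel Term _
_→βη_ = _→β_ ∪ _→η_

data _⇛_ : Term → Term → Set where
  ⇛-var : ∀ {x} → var x ⇛ var x
  ⇛-app : ∀ {s s′ t t′} → s ⇛ s′ → t ⇛ t′ → app s t ⇛ app s′ t′
  ⇛-lam : ∀ {t t′} → t ⇛ t′ → lam t ⇛ lam t′
  ⇛-β   : ∀ {t t′ s s′} → t ⇛ t′ → s ⇛ s′ → app (lam t) s ⇛ t′ [ s′ ]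

⇛-refl : ∀ t → t ⇛ t
⇛-refl (var x)   = ⇛-var
⇛-refl (app s t) = ⇛-app (⇛-refl s) (⇛-refl t)
⇛-refl (lam t)   = ⇛-lam (⇛-refl t)

⇛-rename : ∀ ρ {t t′} → t ⇛ t′ → rename ρ t ⇛ rename ρ t′
⇛-rename ρ ⇛-var       = ⇛-var
⇛-rename ρ (⇛-app p q) = ⇛-app (⇛-rename ρ p) (⇛-rename ρ q)
⇛-rename ρ (⇛-lam p)   = ⇛-lam (⇛-rename (ext ρ) p)
⇛-rename ρ (⇛-β {t′ = t′} {s′ = s′} p q) =
  ≡.subst (_ ⇛_) (sym (rename-[] ρ t′ s′)) (⇛-β (⇛-rename (ext ρ) p) (⇛-rename ρ q))

⇛-exts : (∀ x → σ x ⇛ τ x) → ∀ x → exts σ x ⇛ exts τ x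
⇛-exts στ zero    = ⇛-var
⇛-exts στ (suc x) = ⇛-rename suc (στ x)

⇛-subst : (∀ x → σ x ⇛ τ x) → ∀ {t t′} → t ⇛ t′ → subst σ t ⇛ subst τ t′
⇛-subst στ ⇛-var       = στ _
⇛-subst στ (⇛-app p q) = ⇛-app (⇛-subst στ p) (⇛-subst στ q)
⇛-subst στ (⇛-lam p)   = ⇛-lam (⇛-subst (⇛-exts στ) p)
⇛-subst {τ = τ} στ (⇛-β {t′ = t′} {s′ = s′} p q) =
  ≡.subst (_ ⇛_) (sym (subst-[] τ t′ s′)) (⇛-β (⇛-subst (⇛-exts στ) p) (⇛-subst στ q))

⇛-[] : ∀ {t t′ s s′} → t ⇛ t′ → s ⇛ s′ → t [ s ] ⇛ t′ [ s′ ]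
⇛-[] p q = ⇛-subst (λ { zero → q ; (suc x) → ⇛-var }) p

⇛-diamond : Diamond _⇛_
⇛-diamond ⇛-var ⇛-var = -, ⇛-var , ⇛-var
⇛-diamond (⇛-app p q) (⇛-app p′ q′) with ⇛-diamond p p′ | ⇛-diamond q q′
... | _ , p″ , p‴ | _ , q″ , q‴ = -, ⇛-app p″ q″ , ⇛-app p‴ q‴
⇛-diamond (⇛-lam p) (⇛-lam p′) with ⇛-diamond p p′
... | _ , p″ , p‴ = -, ⇛-lam p″ , ⇛-lam p‴
⇛-diamond (⇛-β p q) (⇛-β p′ q′) with ⇛-diamond p p′ | ⇛-diamond q q′
... | _ , p″ , p‴ | _ , q″ , q‴ = -, ⇛-[] p″ q″ , ⇛-[] p‴ q‴
⇛-diamond (⇛-β p q) (⇛-app (⇛-lam p′) q′) with ⇛-diamond p p′ | ⇛-diamond q q′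
... | _ , p″ , p‴ | _ , q″ , q‴ = -, ⇛-[] p″ q″ , ⇛-β p‴ q‴
⇛-diamond (⇛-app (⇛-lam p) q) (⇛-β p′ q′) with ⇛-diamond p p′ | ⇛-diamond q q′
... | _ , p″ , p‴ | _ , q″ , q‴ = -, ⇛-β p″ q″ , ⇛-[] p‴ q‴

→β⇒⇛ : _→β_ ⇒ _⇛_
→β⇒⇛ (β-contract {t} {s}) = ⇛-β (⇛-refl t) (⇛-refl s)
→β⇒⇛ (β-appˡ {t = t} r)   = ⇛-app (→β⇒⇛ r) (⇛-refl t)
→β⇒⇛ (β-appʳ {s = s} r)   = ⇛-app (⇛-refl s) (→β⇒⇛ r)
→β⇒⇛ (β-lam r)            = ⇛-lam (→β⇒⇛ r)

⇛⇒↠β : _⇛_ ⇒ Star _→β_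
⇛⇒↠β ⇛-var = ε
⇛⇒↠β (⇛-app {s′ = s′} {t = t} p q) =
  Star.gmap (λ u → app u t) β-appˡ (⇛⇒↠β p) ◅◅ Star.gmap (app s′) β-appʳ (⇛⇒↠β q)
⇛⇒↠β (⇛-lam p) = Star.gmap lam β-lam (⇛⇒↠β p)
⇛⇒↠β (⇛-β {t′ = t′} {s = s} p q) =
  Star.gmap (λ u → app (lam u) s) (β-appˡ ∘ β-lam) (⇛⇒↠β p)
  ◅◅ Star.gmap (app (lam t′)) β-appʳ (⇛⇒↠β q) ◅◅ return β-contract

β-confluent : Confluent _→β_
β-confluent = diamond-between⇒confluent →β⇒⇛ ⇛⇒↠β ⇛-diamond

→η-subst : ∀ σ {t t′} → t →η t′ → subst σ t →η subst σ t′
→η-subst σ (η-contract {t = t} refl refl) = η-contract refl (exts-shift σ t)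
→η-subst σ (η-appˡ r) = η-appˡ (→η-subst σ r)
→η-subst σ (η-appʳ r) = η-appʳ (→η-subst σ r)
→η-subst σ (η-lam r)  = η-lam (→η-subst (exts σ) r)

→η-rename : ∀ ρ {t t′} → t →η t′ → rename ρ t →η rename ρ t′
→η-rename ρ (η-contract {t = t} refl refl) = η-contract refl (ext-shift ρ t)
→η-rename ρ (η-appˡ r) = η-appˡ (→η-rename ρ r)
→η-rename ρ (η-appʳ r) = η-appʳ (→η-rename ρ r)
→η-rename ρ (η-lam r)  = η-lam (→η-rename (ext ρ) r)

↠η-subst : (∀ x → Star _→η_ (σ x) (τ x)) → ∀ t → Star _→η_ (subst σ t) (subst τ t)
↠η-subst στ (var x) = στ x
↠η-subst {σ = σ} {τ} στ (app s t) =
  Star.gmap (λ u → app u (subst σ t)) η-appˡ (↠η-subst στ s)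
  ◅◅ Star.gmap (app (subst τ s)) η-appʳ (↠η-subst στ t)
↠η-subst στ (lam t) = Star.gmap lam η-lam (↠η-subst ↠η-exts t)
  where
  ↠η-exts : ∀ x → Star _→η_ (exts _ x) (exts _ x)
  ↠η-exts zero    = ε
  ↠η-exts (suc x) = Star.gmap (rename suc) (→η-rename suc) (στ x)

rename-→η-inverse : ∀ ρ t {u} → rename ρ t →η u → ∃ λ t′ → t →η t′ × u ≡ rename ρ t′
rename-→η-inverse ρ (lam (app b (var zero))) (η-contract refl e)
  with rename-pullback {ext ρ} {suc} {suc} {ρ} pb b _ e
  where
  pb : ∀ x y → ext ρ x ≡ suc y → ∃ λ z → x ≡ suc z × y ≡ ρ z
  pb (suc x) _ refl = x , refl , refl
... | t′ , refl , refl = t′ , η-contract refl refl , refl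
rename-→η-inverse ρ (app s t) (η-appˡ r) with rename-→η-inverse ρ s r
... | s′ , r′ , refl = app s′ t , η-appˡ r′ , refl
rename-→η-inverse ρ (app s t) (η-appʳ r) with rename-→η-inverse ρ t r
... | t′ , r′ , refl = app s t′ , η-appʳ r′ , refl
rename-→η-inverse ρ (lam t) (η-lam r) with rename-→η-inverse (ext ρ) t r
... | t′ , r′ , refl = lam t′ , η-lam r′ , refl

→η-diamond : ∀ {s t u} → s →η t → s →η u → ∃ λ w → ReflClosure _→η_ t w × ReflClosure _→η_ u w
→η-diamond (η-contract refl e) (η-contract refl e′) with shift-injective (trans (sym e) e′)
... | refl = -, Refl.refl , Refl.refl
→η-diamond (η-contract refl refl) (η-lam (η-appˡ r)) with rename-→η-inverse suc _ r
... | t′ , r′ , refl = -, Refl.[ r′ ] , Refl.[ η-contract refl refl ]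
→η-diamond (η-lam (η-appˡ r)) (η-contract refl refl) with rename-→η-inverse suc _ r
... | t′ , r′ , refl = -, Refl.[ η-contract refl refl ] , Refl.[ r′ ]
→η-diamond (η-contract refl _) (η-lam (η-appʳ ()))
→η-diamond (η-lam (η-appʳ ())) (η-contract refl _)
→η-diamond (η-lam r) (η-lam r′) =
  map lam (map (Refl.map η-lam) (Refl.map η-lam)) (→η-diamond r r′)
→η-diamond (η-appˡ r) (η-appˡ r′) =
  map (λ w → app w _) (map (Refl.map η-appˡ) (Refl.map η-appˡ)) (→η-diamond r r′)
→η-diamond (η-appʳ r) (η-appʳ r′) =
  map (app _) (map (Refl.map η-appʳ) (Refl.map η-appʳ)) (→η-diamond r r′)
→η-diamond (η-appˡ r) (η-appʳ r′) = -, Refl.[ η-appʳ r′ ] , Refl.[ η-appˡ r ]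
→η-diamond (η-appʳ r) (η-appˡ r′) = -, Refl.[ η-appˡ r′ ] , Refl.[ η-appʳ r ]

η-confluent : Confluent _→η_
η-confluent = diamond-between⇒confluent Refl.[_] reflClosure⇒star ◇
  where
  ◇ : Diamond (ReflClosure _→η_)
  ◇ Refl.refl q         = -, q , Refl.refl
  ◇ p         Refl.refl = -, Refl.refl , p
  ◇ Refl.[ p ] Refl.[ q ] = →η-diamond p q

rename-→β-inverse : ∀ ρ t {u} → rename ρ t →β u → ∃ λ t′ → t →β t′ × u ≡ rename ρ t′
rename-→β-inverse ρ (app (lam t) s) β-contract = t [ s ] , β-contract , sym (rename-[] ρ t s)
rename-→β-inverse ρ (app s t) (β-appˡ r) with rename-→β-inverse ρ s r
... | s′ , r′ , refl = app s′ t , β-appˡ r′ , refl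
rename-→β-inverse ρ (app s t) (β-appʳ r) with rename-→β-inverse ρ t r
... | t′ , r′ , refl = app s t′ , β-appʳ r′ , refl
rename-→β-inverse ρ (lam t) (β-lam r) with rename-→β-inverse (ext ρ) t r
... | t′ , r′ , refl = lam t′ , β-lam r′ , refl

β-inside-η-redex : ∀ t {u} → app (rename suc t) (var zero) →β u →
  ∃ λ w → Star _→η_ (lam u) w × ReflClosure _→β_ t w
β-inside-η-redex (lam t) β-contract =
  -, ≡⇒star _→η_ (cong lam (ext-shift-[var0] t)) , Refl.refl
β-inside-η-redex t (β-appˡ r) with rename-→β-inverse suc t r
... | t′ , r′ , refl = -, return (η-contract refl refl) , Refl.[ r′ ]

β-η-local : ∀ {s t u} → s →β t → s →η u → ∃ λ w → Star _→η_ t w × ReflClosure _→β_ u w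
β-η-local (β-contract {s = s}) (η-appˡ (η-lam r)) = -, return (→η-subst (single s) r) , Refl.[ β-contract ]
β-η-local (β-contract {s = s}) (η-appˡ (η-contract {t = t} refl refl)) =
  -, ≡⇒star _→η_ (cong (λ f → app f s) (shift-[] t s)) , Refl.refl
β-η-local (β-contract {t} {s}) (η-appʳ r) = -, ↠η-subst s↠s′ t , Refl.[ β-contract ]
  where
  s↠s′ : ∀ x → Star _→η_ (single s x) (single _ x)
  s↠s′ zero    = return r
  s↠s′ (suc x) = ε
β-η-local (β-appˡ r) (η-appˡ r′) =
  map (λ w → app w _) (map (Star.gmap _ η-appˡ) (Refl.map β-appˡ)) (β-η-local r r′)
β-η-local (β-appʳ r) (η-appʳ r′) =
  map (app _) (map (Star.gmap _ η-appʳ) (Refl.map β-appʳ)) (β-η-local r r′)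
β-η-local (β-lam r) (η-lam r′) =
  map lam (map (Star.gmap _ η-lam) (Refl.map β-lam)) (β-η-local r r′)
β-η-local (β-appˡ r) (η-appʳ r′) = -, return (η-appʳ r′) , Refl.[ β-appˡ r ]
β-η-local (β-appʳ r) (η-appˡ r′) = -, return (η-appˡ r′) , Refl.[ β-appʳ r ]
β-η-local (β-lam r) (η-contract {t = t} refl refl) = β-inside-η-redex t r

βη-confluent : Confluent _→βη_
βη-confluent = hindley-rosen β-confluent η-confluent (hindley β-η-local)

-- βη-equality and normal forms

≡βη⇒↔ : ∀ {s t} → s ≡βη t → EqClosure _→βη_ s t
≡βη⇒↔ βη-refl          = ε
≡βη⇒↔ (βη-sym e)       = EqClosure.symmetric _→βη_ (≡βη⇒↔ e)
≡βη⇒↔ (βη-trans e e′)  = ≡βη⇒↔ e ◅◅ ≡βη⇒↔ e′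
≡βη⇒↔ (βη-app {a′ = s′} {b = t} e e′) =
  EqClosure.gmap (λ u → app u t) (Sum.map β-appˡ η-appˡ) (≡βη⇒↔ e)
  ◅◅ EqClosure.gmap (app s′) (Sum.map β-appʳ η-appʳ) (≡βη⇒↔ e′)
≡βη⇒↔ (βη-lam e)       = EqClosure.gmap lam (Sum.map β-lam η-lam) (≡βη⇒↔ e)
≡βη⇒↔ β                = EqClosure.return (inj₁ β-contract)
≡βη⇒↔ η                = EqClosure.return (inj₂ (η-contract refl refl))

↠β⇒↔ : ∀ {s t} → Star _→β_ s t → EqClosure _→βη_ s t
↠β⇒↔ = Star.map (fwd ∘ inj₁)

NotEtaBody : Term → Set
NotEtaBody (app _ (var zero)) = ⊥
NotEtaBody _                  = ⊤

data Normal : Term → Set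
data Neutral : Term → Set

data Neutral where
  var : ∀ {x} → Neutral (var x)
  app : ∀ {s t} → Neutral s → Normal t → Neutral (app s t)

data Normal where
  neutral : ∀ {t} → Neutral t → Normal t
  lam     : ∀ {t} → Normal t → NotEtaBody t → Normal (lam t)

neutral-¬→β : ∀ {t u} → Neutral t → ¬ t →β u
normal-¬→β  : ∀ {t u} → Normal t → ¬ t →β u
neutral-¬→β (app () _) β-contract
neutral-¬→β (app n _) (β-appˡ r) = neutral-¬→β n r
neutral-¬→β (app _ n) (β-appʳ r) = normal-¬→β n r
normal-¬→β (neutral n) r     = neutral-¬→β n r
normal-¬→β (lam n _) (β-lam r) = normal-¬→β n r

neutral-¬→η : ∀ {t u} → Neutral t → ¬ t →η u
normal-¬→η  : ∀ {t u} → Normal t → ¬ t →η u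
neutral-¬→η (app n _) (η-appˡ r) = neutral-¬→η n r
neutral-¬→η (app _ n) (η-appʳ r) = normal-¬→η n r
normal-¬→η (neutral n) r              = neutral-¬→η n r
normal-¬→η (lam n _) (η-lam r)        = normal-¬→η n r
normal-¬→η (lam _ ¬η) (η-contract refl _) = ¬η

normal⇒isNormalForm : ∀ {t} → Normal t → IsNormalForm _→βη_ t
normal⇒isNormalForm n (_ , inj₁ r) = normal-¬→β n r
normal⇒isNormalForm n (_ , inj₂ r) = normal-¬→η n r

-- The iterates of B²

lams : ℕ → Term → Term
lams zero    t = t
lams (suc n) t = lam (lams n t)

lams-+ : ∀ m n t → lams m (lams n t) ≡ lams (m + n) t
lams-+ zero    n t = refl
lams-+ (suc m) n t = cong lam (lams-+ m n t)

lams-↠β : ∀ n {t t′} → Star _→β_ t t′ → Star _→β_ (lams n t) (lams n t′)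
lams-↠β zero    = λ r → r
lams-↠β (suc n) = Star.gmap lam β-lam ∘ lams-↠β n

extsⁿ : ℕ → (ℕ → Term) → ℕ → Term
extsⁿ zero    σ = σ
extsⁿ (suc n) σ = exts (extsⁿ n σ)

extsⁿ-exts : ∀ n σ → extsⁿ n (exts σ) ≗ extsⁿ (suc n) σ
extsⁿ-exts zero    σ = λ _ → refl
extsⁿ-exts (suc n) σ = exts-cong (extsⁿ-exts n σ)

subst-lams : ∀ n σ t → subst σ (lams n t) ≡ lams n (subst (extsⁿ n σ) t)
subst-lams zero    σ t = refl
subst-lams (suc n) σ t =
  cong lam (trans (subst-lams n (exts σ) t) (cong (lams n) (subst-cong (extsⁿ-exts n σ) t)))

extsⁿ-< : ∀ {n x} σ → x < n → extsⁿ n σ x ≡ var x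
extsⁿ-< {suc n} {zero}  σ _         = refl
extsⁿ-< {suc n} {suc x} σ (s≤s x<n) = cong (rename suc) (extsⁿ-< σ x<n)

extsⁿ-single-closed : ∀ {s} → rename suc s ≡ s → ∀ n → extsⁿ n (single s) n ≡ s
extsⁿ-single-closed closed zero    = refl
extsⁿ-single-closed closed (suc n) = trans (cong (rename suc) (extsⁿ-single-closed closed n)) closed

β-lams : ∀ n t s → app (lams (suc n) t) s →β lams n (subst (extsⁿ n (single s)) t)
β-lams n t s = ≡.subst (app (lams (suc n) t) s →β_) (subst-lams n (single s) t) β-contract

nestHead : ℕ → ℕ
nestHead zero    = 2
nestHead (suc a) = suc (suc (nestHead a))

nestWidth : ℕ → ℕ
nestWidth a = suc (nestHead a)

nest : ℕ → ℕ → Term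
nest zero    i = app (app (var (2 + i)) (var (1 + i))) (var i)
nest (suc a) i = app (app (var (nestHead (suc a) + i)) (nest a (suc i))) (var i)

nest-shift : ∀ a i → rename suc (nest a i) ≡ nest a (suc i)
nest-shift zero    i = refl
nest-shift (suc a) i =
  cong₂ (λ x t → app (app (var x) t) (var (suc i))) (sym (+-suc (nestHead (suc a)) i)) (nest-shift a (suc i))

subst-nest : ∀ σ a i {n} → nestHead a + i < n → subst (extsⁿ n σ) (nest a i) ≡ nest a i
subst-nest σ zero i h =
  cong₂ app (cong₂ app (extsⁿ-< σ h) (extsⁿ-< σ (<⇒≤ h))) (extsⁿ-< σ (<⇒≤ (<⇒≤ h)))
subst-nest σ (suc a) i {n} h =
  cong₂ app (cong₂ app (extsⁿ-< σ h) (subst-nest σ a (suc i) (≡.subst (_< n) (sym (+-suc (nestHead a) i)) (<⇒≤ h))))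
            (extsⁿ-< σ (≤-<-trans (m≤n+m i _) h))

nest-neutral : ∀ a i → Neutral (nest a i)
nest-neutral zero    i = app (app var (neutral var)) (neutral var)
nest-neutral (suc a) i = app (app var (neutral (nest-neutral a (suc i)))) (neutral var)

data Shape : Set where
  twoNests : ℕ → ℕ → Shape
  oneNest  : ℕ → Shape

shapeTerm : Shape → Term
shapeTerm (twoNests a b) = lams (nestWidth a + nestWidth b) (app (nest a (nestWidth b)) (nest b 0))
shapeTerm (oneNest c)    = lams (suc (nestWidth c)) (app (var (nestWidth c)) (nest c 0))

nextShape : Shape → Shape
nextShape (twoNests (suc a) b) = twoNests a (suc b)
nextShape (twoNests zero b)    = oneNest (suc b)
nextShape (oneNest c)          = twoNests c 0

B²-↠β : Star _→β_ B² (shapeTerm (oneNest 0))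
B²-↠β = β-appˡ β-contract ◅ β-contract ◅ β-lam β-contract
      ◅ β-lam (β-lam (β-lam (β-appˡ β-contract))) ◅ β-lam (β-lam (β-lam β-contract)) ◅ ε

exts-single-shift : ∀ s t → subst (exts (single s)) (rename suc (rename suc t)) ≡ rename suc t
exts-single-shift s t = trans (exts-shift (single s) (rename suc t)) (cong (rename suc) (shift-[] t s))

B²-three : ∀ u v w → Star _→β_ (app (app (app B² u) v) w)
  (lam (app (rename suc u) (app (app (rename suc v) (rename suc w)) (var zero))))
B²-three u v w = begin
  app (app (app B² u) v) w
    ⟶*⟨ Star.gmap (λ f → app (app (app f u) v) w) (β-appˡ ∘ β-appˡ ∘ β-appˡ) B²-↠β ⟩
  app (app (app (shapeTerm (oneNest 0)) u) v) w
    ⟶⟨ β-appˡ (β-appˡ β-contract) ⟩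
  _ ⟶⟨ β-appˡ β-contract ⟩
  _ ⟶⟨ β-contract ⟩
  lam (app (subst (exts (single w)) (subst (exts (exts (single v))) (↑ (↑ (↑ u)))))
           (app (app (subst (exts (single w)) (↑ (↑ v))) (↑ w)) (var zero)))
    ≡⟨ cong₂ (λ u′ v′ → lam (app u′ (app (app v′ (↑ w)) (var zero)))) u-shifts (exts-single-shift w v) ⟩
  lam (app (↑ u) (app (app (↑ v) (↑ w)) (var zero))) ∎
  where
  open StarReasoning _→β_
  ↑ : Term → Term
  ↑ = rename suc
  u-shifts : subst (exts (single w)) (subst (exts (exts (single v))) (↑ (↑ (↑ u)))) ≡ ↑ u
  u-shifts = trans (cong (subst (exts (single w)))
                         (trans (exts-shift (exts (single v)) (↑ (↑ u))) (cong ↑ (exts-single-shift v u))))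
                   (exts-single-shift w u)

B²-one : ∀ u → Star _→β_ (app B² u)
  (lams 3 (app (rename suc (rename suc (rename suc u))) (app (app (var 2) (var 1)) (var 0))))
B²-one u = Star.gmap (λ f → app f u) β-appˡ B²-↠β ◅◅ return β-contract

lams-suc : ∀ n t → lams n (lam t) ≡ lams (suc n) t
lams-suc n t = trans (lams-+ n 1 t) (cong (λ k → lams k t) (+-comm n 1))

shapeTerm-step : ∀ s → Star _→β_ (app (shapeTerm s) B²) (shapeTerm (nextShape s))
shapeTerm-step (twoNests (suc a) b) = begin
  app (shapeTerm (twoNests (suc a) b)) B²
    ⟶⟨ β-lams N _ B² ⟩
  lams N (subst (extsⁿ N (single B²)) (app (nest (suc a) wb) (nest b 0)))
    ≡⟨ cong (lams N) (cong₂ app (cong₂ app (cong₂ app (extsⁿ-single-closed refl N)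
                                                      (subst-nest _ a (suc wb) head-a<N))
                                           (extsⁿ-< _ wb<N))
                                (subst-nest _ b 0 head-b<N)) ⟩
  lams N (app (app (app B² (nest a (suc wb))) (var wb)) (nest b 0))
    ⟶*⟨ lams-↠β N (B²-three _ _ _) ⟩
  lams N (lam (app (rename suc (nest a (suc wb))) (app (app (var (suc wb)) (rename suc (nest b 0))) (var 0))))
    ≡⟨ trans (lams-suc N _) (cong₂ lams (sym (trans (+-suc wa (suc wb)) (cong suc (+-suc wa wb))))
         (cong₂ app (nest-shift a (suc wb))
                    (cong₂ (λ x t → app (app (var x) t) (var 0)) (sym (+-identityʳ _)) (nest-shift b 0)))) ⟩
  shapeTerm (twoNests a (suc b)) ∎
  where
  open StarReasoning _→β_
  wa = nestWidth a
  wb = nestWidth b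
  N = suc (wa + wb)
  wb<N : wb < N
  wb<N = s≤s (m≤n+m wb wa)
  head-a<N : nestHead a + suc wb < N
  head-a<N = ≡.subst (_< N) (sym (+-suc (nestHead a) wb)) (n<1+n _)
  head-b<N : nestHead b + 0 < N
  head-b<N = ≡.subst (_< N) (sym (+-identityʳ (nestHead b))) (<-trans (n<1+n _) wb<N)
shapeTerm-step (twoNests zero b) = begin
  app (shapeTerm (twoNests zero b)) B²
    ⟶⟨ β-lams N _ B² ⟩
  lams N (subst (extsⁿ N (single B²)) (app (nest zero wb) (nest b 0)))
    ≡⟨ cong (lams N) (cong₂ app (cong₂ app (cong₂ app (extsⁿ-single-closed refl N)
                                                      (extsⁿ-< _ (n<1+n _)))
                                           (extsⁿ-< _ wb<N))
                                (subst-nest _ b 0 head-b<N)) ⟩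
  lams N (app (app (app B² (var (suc wb))) (var wb)) (nest b 0))
    ⟶*⟨ lams-↠β N (B²-three _ _ _) ⟩
  lams N (lam (app (var N) (app (app (var (suc wb)) (rename suc (nest b 0))) (var 0))))
    ≡⟨ trans (lams-suc N _)
         (cong (λ t → lams (suc N) (app (var N) t))
               (cong₂ (λ x t → app (app (var x) t) (var 0)) (sym (+-identityʳ _)) (nest-shift b 0))) ⟩
  shapeTerm (oneNest (suc b)) ∎
  where
  open StarReasoning _→β_
  wb = nestWidth b
  N = suc (suc wb)
  wb<N : wb < N
  wb<N = <-trans (n<1+n _) (n<1+n _)
  head-b<N : nestHead b + 0 < N
  head-b<N = ≡.subst (_< N) (sym (+-identityʳ (nestHead b))) (<-trans (n<1+n _) wb<N)
shapeTerm-step (oneNest c) = begin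
  app (shapeTerm (oneNest c)) B²
    ⟶⟨ β-lams wc _ B² ⟩
  lams wc (subst (extsⁿ wc (single B²)) (app (var wc) (nest c 0)))
    ≡⟨ cong (lams wc) (cong₂ app (extsⁿ-single-closed refl wc) (subst-nest _ c 0 head-c<wc)) ⟩
  lams wc (app B² (nest c 0))
    ⟶*⟨ lams-↠β wc (B²-one _) ⟩
  lams wc (lams 3 (app (rename suc (rename suc (rename suc (nest c 0)))) (nest 0 0)))
    ≡⟨ trans (lams-+ wc 3 _) (cong (λ t → lams (wc + 3) (app t (nest 0 0))) nest-shift³) ⟩
  shapeTerm (twoNests c 0) ∎
  where
  open StarReasoning _→β_
  wc = nestWidth c
  head-c<wc : nestHead c + 0 < wc
  head-c<wc = ≡.subst (_< wc) (sym (+-identityʳ (nestHead c))) (n<1+n _)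
  nest-shift³ : rename suc (rename suc (rename suc (nest c 0))) ≡ nest c 3
  nest-shift³ = trans (cong (rename suc) (trans (cong (rename suc) (nest-shift c 0)) (nest-shift c 1)))
                      (nest-shift c 2)

shapeOf : ℕ → Shape
shapeOf zero    = oneNest 0
shapeOf (suc k) = nextShape (shapeOf k)

copies-↠β : ∀ k → Star _→β_ (copies B² (suc k)) (shapeTerm (shapeOf k))
copies-↠β zero    = B²-↠β
copies-↠β (suc k) = Star.gmap (λ t → app t B²) β-appˡ (copies-↠β k) ◅◅ shapeTerm-step (shapeOf k)

triangle : ℕ → ℕ
triangle zero    = 0
triangle (suc n) = suc n + triangle n

-- The shapes run through the diagonals a + b = d from (d , 0) to (0 , d), each followed by oneNest (d + 1).
position : Shape → ℕ
position (twoNests a b) = triangle (suc (a + b)) + b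
position (oneNest c)    = triangle c + c

position-nextShape : ∀ s → position (nextShape s) ≡ suc (position s)
position-nextShape (twoNests (suc a) b) =
  trans (cong (λ n → triangle (suc n) + suc b) (+-suc a b)) (+-suc (triangle (suc (suc (a + b)))) b)
position-nextShape (twoNests zero b) = +-suc (triangle (suc b)) b
position-nextShape (oneNest c) =
  trans (cong (λ n → triangle (suc n) + 0) (+-identityʳ c))
        (trans (+-identityʳ _) (cong suc (+-comm c (triangle c))))

position-shapeOf : ∀ k → position (shapeOf k) ≡ k
position-shapeOf zero    = refl
position-shapeOf (suc k) = trans (position-nextShape (shapeOf k)) (cong suc (position-shapeOf k))

nest-≢-var : ∀ a i x → nest a i ≢ var x
nest-≢-var zero    i x ()
nest-≢-var (suc a) i x ()

nest-injective : ∀ a a′ i i′ → nest a i ≡ nest a′ i′ → a ≡ a′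
nest-injective zero    zero     i i′ e = refl
nest-injective zero    (suc a′) i i′ e =
  ⊥-elim (nest-≢-var a′ _ _ (sym (proj₂ (app-injective (proj₁ (app-injective e))))))
nest-injective (suc a) zero     i i′ e =
  ⊥-elim (nest-≢-var a _ _ (proj₂ (app-injective (proj₁ (app-injective e)))))
nest-injective (suc a) (suc a′) i i′ e =
  cong suc (nest-injective a a′ _ _ (proj₂ (app-injective (proj₁ (app-injective e)))))

lams-app-injective : ∀ m n {s t s′ t′} → lams m (app s t) ≡ lams n (app s′ t′) → s ≡ s′ × t ≡ t′
lams-app-injective zero    zero    e = app-injective e
lams-app-injective (suc m) (suc n) e = lams-app-injective m n (lam-injective e)

shapeTerm-injective : ∀ s s′ → shapeTerm s ≡ shapeTerm s′ → s ≡ s′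
shapeTerm-injective (twoNests a b) (twoNests a′ b′) e with lams-app-injective _ _ e
... | ea , eb = cong₂ twoNests (nest-injective a a′ _ _ ea) (nest-injective b b′ 0 0 eb)
shapeTerm-injective (twoNests a b) (oneNest c) e =
  ⊥-elim (nest-≢-var a _ _ (proj₁ (lams-app-injective _ _ e)))
shapeTerm-injective (oneNest c) (twoNests a b) e =
  ⊥-elim (nest-≢-var a _ _ (sym (proj₁ (lams-app-injective _ _ e))))
shapeTerm-injective (oneNest c) (oneNest c′) e =
  cong oneNest (nest-injective c c′ 0 0 (proj₂ (lams-app-injective _ _ e)))

app-nest-notEtaBody : ∀ s a i → NotEtaBody (app s (nest a i))
app-nest-notEtaBody s zero    i = _
app-nest-notEtaBody s (suc a) i = _

lams-normal : ∀ n {t} → Normal t → NotEtaBody t → Normal (lams n t) × NotEtaBody (lams n t)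
lams-normal zero    nt ¬η = nt , ¬η
lams-normal (suc n) nt ¬η = lam (proj₁ (lams-normal n nt ¬η)) (proj₂ (lams-normal n nt ¬η)) , _

shapeTerm-normal : ∀ s → Normal (shapeTerm s)
shapeTerm-normal (twoNests a b) =
  proj₁ (lams-normal _ (neutral (app (nest-neutral a _) (neutral (nest-neutral b 0)))) (app-nest-notEtaBody _ b 0))
shapeTerm-normal (oneNest c) =
  proj₁ (lams-normal _ (neutral (app var (neutral (nest-neutral c 0)))) (app-nest-notEtaBody _ c 0))

βη-equal-normal-forms : ∀ {s t} → Normal s → Normal t → EqClosure _→βη_ s t → s ≡ t
βη-equal-normal-forms ns nt = conf⇒unf βη-confluent (normal⇒isNormalForm ns) (normal⇒isNormalForm nt)

copies-≡βη⇒shapeOf-≡ : ∀ i j → copies B² (suc i) ≡βη copies B² (suc j) → shapeOf i ≡ shapeOf j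
copies-≡βη⇒shapeOf-≡ i j e = shapeTerm-injective _ _
  (βη-equal-normal-forms (shapeTerm-normal (shapeOf i)) (shapeTerm-normal (shapeOf j))
    (EqClosure.symmetric _→βη_ (↠β⇒↔ (copies-↠β i)) ◅◅ ≡βη⇒↔ e ◅◅ ↠β⇒↔ (copies-↠β j)))

theorem3p6 : ¬ HasRho B²
theorem3p6 (zero  , _     , ()    , _)
theorem3p6 (suc _ , zero  , _ , ()  , _)
theorem3p6 (suc i , suc j , _ , _ , i≢j , e) = i≢j (cong suc (begin
  i                     ≡⟨ position-shapeOf i ⟨
  position (shapeOf i)  ≡⟨ cong position (copies-≡βη⇒shapeOf-≡ i j e) ⟩
  position (shapeOf j)  ≡⟨ position-shapeOf j ⟩
  j                     ∎))
  where open ≡-Reasoning
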